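{- Let $r$ be a positive integer and let $\mu\subseteq\mathbb N$ be a non-empty finite or co-finite set. There is a DN neighborhood term $t_{r,\mu}(X)$ such that for every graph $G$ and every $U\subseteq V(G)$, the value of $t_{r,\mu}$ with $X\mapsto U$ in $G$ is $\{v\in V(G):|N^r(v)\cap U|\in\mu\}$.
   Context: $N^r(v)=\{u\in V(G)\setminus\{v\}:\mathrm{dist}_G(u,v)\le r\}$; for $d,r\in\mathbb N^+$, $N^r_d(U)=\{v:|N^r(v)\cap U|\ge d\}$. DN neighborhood terms are built from set variables, unary relation symbols (interpreted as vertex subsets) and $\emptyset$ by complement (in $V(G)$), $\cap$, $\cup$, $\setminus$ and $N^r_d(\cdot)$ for $d,r\in\mathbb N^+$, and under an assignment of vertex sets to set variables denote vertex sets in the obvious way. -}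

module Defs where

open import Data.Nat using (ℕ; zero; suc; _≤_; _<_)
open import Data.Bool using (Bool; true; false; _∧_; _∨_; not)
open import Data.Fin using (Fin; _≟_)
open import Data.Fin.Subset using (Subset; ∁; _∩_; _∪_; _─_; ∣_∣)
import Data.Fin.Subset as S
open import Data.List using (allFin)
open import Data.Bool.ListAction using (any)
open import Data.Vec using (tabulate)
open import Data.Product using (∃; _×_)
open import Data.Sum using (_⊎_)
open import Relation.Nullary.Decidable using (⌊_⌋)
open import Relation.Binary.PropositionalEquality using (_≡_)

record Graph (n : ℕ) : Set where
  field
    adj   : Fin n → Fin n → Bool
    sym   : ∀ u v → adj u v ≡ adj v u
    irrefl : ∀ v → adj v v ≡ false
open Graph public

reach : ∀ {n} → Graph n → ℕ → Fin n → Fin n → Bool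
reach G zero    u v = ⌊ u ≟ v ⌋
reach G (suc r) u v =
  reach G r u v ∨ any (λ w → reach G r u w ∧ adj G w v) (allFin _)

Nr : ∀ {n} → Graph n → ℕ → Fin n → Subset n
Nr G r v = tabulate (λ u → not ⌊ u ≟ v ⌋ ∧ reach G r v u)

Nrd : ∀ {n} → Graph n → ℕ → ℕ → Subset n → Subset n
Nrd G d r U = tabulate (λ v → ⌊ d Data.Nat.≤? ∣ Nr G r v ∩ U ∣ ⌋)

data Term (k : ℕ) : Set where
  var   : Fin k → Term k
  rel   : ℕ → Term k
  empty : Term k
  compl : Term k → Term k
  inter : Term k → Term k → Term k
  union : Term k → Term k → Term k
  diff  : Term k → Term k → Term k
  nbr   : (d r : ℕ) → 1 ≤ d → 1 ≤ r → Term k → Term k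

⟦_⟧ : ∀ {k n} → Term k → Graph n → (ℕ → Subset n) → (Fin k → Subset n) → Subset n
⟦ var x ⟧ G P σ = σ x
⟦ rel i ⟧ G P σ = P i
⟦ empty ⟧ G P σ = S.⊥
⟦ compl t ⟧ G P σ = ∁ (⟦ t ⟧ G P σ)
⟦ inter t s ⟧ G P σ = ⟦ t ⟧ G P σ ∩ ⟦ s ⟧ G P σ
⟦ union t s ⟧ G P σ = ⟦ t ⟧ G P σ ∪ ⟦ s ⟧ G P σ
⟦ diff t s ⟧ G P σ = ⟦ t ⟧ G P σ ─ ⟦ s ⟧ G P σ
⟦ nbr d r _ _ t ⟧ G P σ = Nrd G d r (⟦ t ⟧ G P σ)

-- μ ⊆ ℕ given by its characteristic function.
Finite : (ℕ → Bool) → Set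
Finite μ = ∃ λ N → ∀ m → N ≤ m → μ m ≡ false

Cofinite : (ℕ → Bool) → Set
Cofinite μ = ∃ λ N → ∀ m → N ≤ m → μ m ≡ true

NonEmpty : (ℕ → Bool) → Set
NonEmpty μ = ∃ λ m → μ m ≡ true

target : ∀ {n} → Graph n → ℕ → (ℕ → Bool) → Subset n → Subset n
target G r μ U = tabulate (λ v → μ ∣ Nr G r v ∩ U ∣)

{-# OPTIONS --safe #-}
-- Membership of v in N^r_d(X) depends only on the count c(v) = |N^r(v) ∩ U|,
-- and the Boolean operations act pointwise, so every term in X denotes
-- { v : g (c v) } for some g : ℕ → Bool. Thresholds "c ≥ d" are the terms
-- N^r_d(X); "c = i" is "c ≥ i and not c ≥ i+1"; a union of such singletons
-- covers the part of μ below a bound N, and in the co-finite case one more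
-- threshold "c ≥ N" adds the tail.
module Submission where

open import Defs hiding (sym)
open import Data.Nat using (ℕ; zero; suc; _≤_; _≤?_; _<?_; s≤s; z≤n)
open import Data.Nat.Properties
  using (_≟_; ≤-refl; <⇒≤; <⇒≢; >⇒≢; <⇒≱; <-asym; ≤⇒≯; <-irrefl; <-cmp; n<1+n; m<n⇒m<1+n; ≮⇒≥)
open import Data.Bool using (Bool; true; false; _∧_; _∨_; not; if_then_else_)
open import Data.Bool.Properties using (∧-zeroʳ; ∧-identityʳ; ∨-identityʳ)
import Data.Fin as Fin
open import Data.Fin.Subset using (Subset; ∣_∣; _∩_)
open import Data.Vec using (lookup)
open import Data.Vec.Properties
  using (lookup-map; lookup-zipWith; lookup-replicate; lookup∘tabulate; tabulate∘lookup; tabulate-cong)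
open import Data.Product using (Σ; _,_)
open import Data.Sum using (_⊎_; inj₁; inj₂)
open import Function using (_∘_)
open import Relation.Binary using (tri<; tri≈; tri>)
open import Relation.Binary.PropositionalEquality using (_≡_; _≗_; refl; sym; trans; cong; cong₂)
open import Relation.Nullary using (Dec; yes; no; ¬_; contradiction)
open import Relation.Nullary.Decidable using (⌊_⌋; isYes≗does; dec-true; dec-false)

⌊⌋-yes : ∀ {A : Set} (a? : Dec A) → A → ⌊ a? ⌋ ≡ true
⌊⌋-yes a? a = trans (isYes≗does a?) (dec-true a? a)

⌊⌋-no : ∀ {A : Set} (a? : Dec A) → ¬ A → ⌊ a? ⌋ ≡ false
⌊⌋-no a? ¬a = trans (isYes≗does a?) (dec-false a? ¬a)

≤∧≰suc≡≟ : ∀ i m → (⌊ i ≤? m ⌋ ∧ not ⌊ suc i ≤? m ⌋) ≡ ⌊ i ≟ m ⌋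
≤∧≰suc≡≟ i m with <-cmp i m
... | tri< i<m _ _
  rewrite ⌊⌋-yes (i ≤? m) (<⇒≤ i<m) | ⌊⌋-yes (suc i ≤? m) i<m | ⌊⌋-no (i ≟ m) (<⇒≢ i<m) = refl
... | tri≈ _ refl _
  rewrite ⌊⌋-yes (i ≤? i) ≤-refl | ⌊⌋-no (suc i ≤? i) (<-irrefl refl) | ⌊⌋-yes (i ≟ i) refl = refl
... | tri> _ _ m<i
  rewrite ⌊⌋-no (i ≤? m) (<⇒≱ m<i) | ⌊⌋-no (i ≟ m) (>⇒≢ m<i) = refl

<suc≡<∨≟ : ∀ (μ : ℕ → Bool) N m →
  (⌊ m <? N ⌋ ∧ μ m ∨ μ N ∧ ⌊ N ≟ m ⌋) ≡ ⌊ m <? suc N ⌋ ∧ μ m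
<suc≡<∨≟ μ N m with <-cmp m N
... | tri< m<N _ _
  rewrite ⌊⌋-yes (m <? N) m<N | ⌊⌋-no (N ≟ m) (>⇒≢ m<N) | ⌊⌋-yes (m <? suc N) (m<n⇒m<1+n m<N)
        | ∧-zeroʳ (μ N) = ∨-identityʳ (μ m)
... | tri≈ _ refl _
  rewrite ⌊⌋-no (m <? m) (<-irrefl refl) | ⌊⌋-yes (m ≟ m) refl | ⌊⌋-yes (m <? suc m) (n<1+n m) =
  ∧-identityʳ (μ m)
... | tri> _ _ N<m
  rewrite ⌊⌋-no (m <? N) (<-asym N<m) | ⌊⌋-no (N ≟ m) (<⇒≢ N<m) | ⌊⌋-no (m <? suc N) (≤⇒≯ N<m) =
  ∧-zeroʳ (μ N)

below≗finite : ∀ {μ : ℕ → Bool} ((N , μ≥N≡false) : Finite μ) → (λ m → ⌊ m <? N ⌋ ∧ μ m) ≗ μ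
below≗finite (N , μ≥N≡false) m with m <? N
... | yes _ = refl
... | no m≮N = sym (μ≥N≡false m (≮⇒≥ m≮N))

tail∨below≗cofinite : ∀ {μ : ℕ → Bool} ((N , μ≥N≡true) : Cofinite μ) →
  (λ m → ⌊ N ≤? m ⌋ ∨ (⌊ m <? N ⌋ ∧ μ m)) ≗ μ
tail∨below≗cofinite (N , μ≥N≡true) m with N ≤? m | m <? N
... | yes N≤m | _ = sym (μ≥N≡true m N≤m)
... | no _ | yes _ = refl
... | no N≰m | no m≮N = contradiction (≮⇒≥ m≮N) N≰m

module _ (r : ℕ) (1≤r : 1 ≤ r) where

  record Realises (t : Term 1) (g : ℕ → Bool) : Set where
    constructor realises
    field
      lookup-⟦⟧ : ∀ n (G : Graph n) P U v → lookup (⟦ t ⟧ G P (λ _ → U)) v ≡ g ∣ Nr G r v ∩ U ∣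
  open Realises

  realises-cong : ∀ {t g h} → g ≗ h → Realises t g → Realises t h
  realises-cong g≗h t∼g = realises λ n G P U v → trans (lookup-⟦⟧ t∼g n G P U v) (g≗h _)

  realises⇒≡target : ∀ {t μ} → Realises t μ →
    ∀ n (G : Graph n) P U → ⟦ t ⟧ G P (λ _ → U) ≡ target G r μ U
  realises⇒≡target t∼μ n G P U =
    trans (sym (tabulate∘lookup _)) (tabulate-cong (lookup-⟦⟧ t∼μ n G P U))

  empty-realises : Realises empty (λ _ → false)
  empty-realises = realises λ n G P U v → lookup-replicate v false

  compl-realises : ∀ {t g} → Realises t g → Realises (compl t) (not ∘ g)
  compl-realises {t} t∼g = realises λ n G P U v →
    trans (lookup-map v not (⟦ t ⟧ G P (λ _ → U))) (cong not (lookup-⟦⟧ t∼g n G P U v))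

  inter-realises : ∀ {t s g h} → Realises t g → Realises s h → Realises (inter t s) (λ m → g m ∧ h m)
  inter-realises {t} {s} t∼g s∼h = realises λ n G P U v →
    trans (lookup-zipWith _∧_ v (⟦ t ⟧ G P (λ _ → U)) (⟦ s ⟧ G P (λ _ → U)))
          (cong₂ _∧_ (lookup-⟦⟧ t∼g n G P U v) (lookup-⟦⟧ s∼h n G P U v))

  union-realises : ∀ {t s g h} → Realises t g → Realises s h → Realises (union t s) (λ m → g m ∨ h m)
  union-realises {t} {s} t∼g s∼h = realises λ n G P U v →
    trans (lookup-zipWith _∨_ v (⟦ t ⟧ G P (λ _ → U)) (⟦ s ⟧ G P (λ _ → U)))
          (cong₂ _∨_ (lookup-⟦⟧ t∼g n G P U v) (lookup-⟦⟧ s∼h n G P U v))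

  -- N^r_d requires d ≥ 1, so the threshold 0 is the complement of ∅.
  atLeast : ℕ → Term 1
  atLeast zero    = compl empty
  atLeast (suc d) = nbr (suc d) r (s≤s z≤n) 1≤r (var Fin.zero)

  atLeast-realises : ∀ d → Realises (atLeast d) (λ m → ⌊ d ≤? m ⌋)
  atLeast-realises zero    = compl-realises empty-realises
  atLeast-realises (suc d) = realises λ n G P U v → lookup∘tabulate _ v

  exactly : ℕ → Term 1
  exactly i = inter (atLeast i) (compl (atLeast (suc i)))

  exactly-realises : ∀ i → Realises (exactly i) (λ m → ⌊ i ≟ m ⌋)
  exactly-realises i =
    realises-cong (≤∧≰suc≡≟ i)
      (inter-realises (atLeast-realises i) (compl-realises (atLeast-realises (suc i))))

  module _ (μ : ℕ → Bool) where

    exactlyIf : ℕ → Term 1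
    exactlyIf i = if μ i then exactly i else empty

    exactlyIf-realises : ∀ i → Realises (exactlyIf i) (λ m → μ i ∧ ⌊ i ≟ m ⌋)
    exactlyIf-realises i with μ i
    ... | true  = exactly-realises i
    ... | false = empty-realises

    below : ℕ → Term 1
    below zero    = empty
    below (suc N) = union (below N) (exactlyIf N)

    below-realises : ∀ N → Realises (below N) (λ m → ⌊ m <? N ⌋ ∧ μ m)
    below-realises zero    = empty-realises
    below-realises (suc N) =
      realises-cong (<suc≡<∨≟ μ N) (union-realises (below-realises N) (exactlyIf-realises N))

lemma6p2 : (r : ℕ) → 1 ≤ r → (μ : ℕ → Bool) → NonEmpty μ → (Finite μ ⊎ Cofinite μ) →
    Σ (Term 1) λ t → ∀ (n : ℕ) (G : Graph n) (P : ℕ → Subset n) (U : Subset n) →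
    ⟦ t ⟧ G P (λ _ → U) ≡ target G r μ U
lemma6p2 r 1≤r μ _ (inj₁ fin@(N , _)) =
  below r 1≤r μ N ,
  realises⇒≡target r 1≤r (realises-cong r 1≤r (below≗finite fin) (below-realises r 1≤r μ N))
lemma6p2 r 1≤r μ _ (inj₂ cof@(N , _)) =
  union (atLeast r 1≤r N) (below r 1≤r μ N) ,
  realises⇒≡target r 1≤r
    (realises-cong r 1≤r (tail∨below≗cofinite cof)
      (union-realises r 1≤r (atLeast-realises r 1≤r N) (below-realises r 1≤r μ N)))
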